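{- Let $m$ be a power of $2$, $d=\log m$, and $w_i=m/2^i$ for $0\le i\le d$. For each $0\le i<d$, let $(S_{(i+1)j})_{j=1}^{w_{i+1}}$ be a family of subsets of $[w_i]$ satisfying: (1) for every $x\in\{0,1\}^{w_i}$, $\Pr_j[|\overline{x|_{S_{(i+1)j}}}-\overline{x}|>1/10]\le 6/10$; (2) for all $\eta<1/10$ and every $x\in\{0,1\}^{w_i}$ with $\overline{x}\ge1-\eta$, $\Pr_j[\overline{x|_{S_{(i+1)j}}}<8/10]\le\eta/2$; (3) all sets have the same constant size (here $j$ is uniform in $[w_{i+1}]$). Consider the layered circuit $\Gamma_m$ whose layer $0$ consists of the $m$ inputs and whose layer $i+1$ consists of gates $L_{(i+1)j}$, $j\in[w_{i+1}]$, where $L_{(i+1)j}=\mathrm{Thr}_{0.8}$ applied to the outputs of the layer-$i$ gates indexed by $S_{(i+1)j}$. Let $y_0\in\{0,1\}^m$ satisfy $\overline{y_0}\ge 9/10$ and let $y_i\in\{0,1\}^{w_i}$ be the output string of layer $i$ when the circuit is evaluated on input $y_0$. Then for all $i$, $\overline{y_i}\ge 1-\frac{2^{ -i}}{10}$.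
   Context: For a bit string $x$, $\overline{x}$ denotes its fraction of ones, and $\overline{x|_S}$ is the average of $x$ over positions in $S$. $\mathrm{Thr}_{\delta}$ applied to a collection of bits outputs $1$ iff at least a $\delta$-fraction of them are $1$. Such set families exist by the paper's sampler theorem with parameters $(\epsilon,\delta,\gamma)=(1/10,6/10,8/10)$ on $N=w_i$. -}

module Defs where

open import Data.Bool using (Bool; true; false; _∧_)
open import Data.Nat as ℕ using (ℕ; zero; suc; _∸_; _^_)
open import Data.Integer using (+_)
open import Data.Fin using (Fin) renaming (zero to fzero; suc to fsuc)
open import Data.Fin.Subset using (Subset; ∣_∣)
open import Data.Vec using (lookup)
open import Data.Rational using (ℚ; 0ℚ; _/_; _*_; _≤_; 1ℚ; ½)
open import Data.Rational.Properties using (_≤?_)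
open import Relation.Nullary using (does)

countT : ∀ {n} → (Fin n → Bool) → ℕ
countT {zero}  p = 0
countT {suc n} p with p fzero
... | true  = suc (countT (λ k → p (fsuc k)))
... | false = countT (λ k → p (fsuc k))

-- the rational a/b, with the (never used in the theorem) convention a/0 = 0
frac : ℕ → ℕ → ℚ
frac a zero    = 0ℚ
frac a (suc b) = (+ a) / suc b

toℚ : ℕ → ℚ
toℚ n = (+ n) / 1

avg : ∀ {n} → (Fin n → Bool) → ℚ
avg {n} x = frac (countT x) n

onesIn : ∀ {n} → Subset n → (Fin n → Bool) → ℕ
onesIn S x = countT (λ k → lookup S k ∧ x k)

avgOn : ∀ {n} → Subset n → (Fin n → Bool) → ℚ
avgOn S x = frac (onesIn S x) ∣ S ∣

prob : ∀ {n} → (Fin n → Bool) → ℚ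
prob {n} P = frac (countT P) n

thr : ∀ {n} → ℚ → Subset n → (Fin n → Bool) → Bool
thr δ S x = does (δ * toℚ ∣ S ∣ ≤? toℚ (onesIn S x))

pow½ : ℕ → ℚ
pow½ zero    = 1ℚ
pow½ (suc i) = ½ * pow½ i

-- widths w_i = m / 2^i = 2^(d - i), where m = 2^d
width : ℕ → ℕ → ℕ
width d i = 2 ^ (d ∸ i)

-- a system of set families: for layer i+1, S i j ⊆ [w_i], j ∈ [w_{i+1}]
Families : ℕ → Set
Families d = (i : ℕ) → Fin (width d (suc i)) → Subset (width d i)

layer : (d : ℕ) → Families d → (Fin (2 ^ d) → Bool) → (i : ℕ) → Fin (width d i) → Bool
layer d S y0 zero      = y0
layer d S y0 (suc i) j = thr ((+ 8) / 10) (S i j) (layer d S y0 i)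

-- The fraction of zeros at least halves from one layer to the next: a gate outputs 0 only if
-- its set sees fewer than 8/10 ones, and condition (2), applied with η the fraction of zeros
-- of the previous layer, bounds the proportion of such gates by η/2.  So layer i has at most
-- a 2^{-i}/10 fraction of zeros.  Condition (2) only
-- applies when η < 1/10 strictly, which at layer 0 holds because η has a power of two as
-- denominator and hence is never exactly 1/10.
module Submission where

open import Defs
open import Data.Bool using (Bool)
open import Data.Nat using (ℕ; _<_; suc)
open import Data.Nat as ℕ using ()
open import Data.Fin using (Fin)
open import Data.Fin.Subset using () renaming (∣_∣ to size)
open import Data.Integer using (+_)
open import Data.Product using (∃)
open import Data.Rational using (ℚ; _/_; _-_; _*_; ∣_∣; 1ℚ; ½) renaming (_≤_ to _≤ℚ_; _<_ to _<ℚ_)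
open import Data.Rational.Properties using (_<?_)
open import Relation.Nullary using (does)
open import Relation.Binary.PropositionalEquality using (_≡_)

open import Function using (_∘_; case_of_)
open import Data.Bool using (true; false; not)
open import Data.Bool.Properties using (not-injective)
open import Data.Nat using (zero; z≤n; s≤s; _∸_)
import Data.Nat.Properties as ℕP
open import Data.Nat.Divisibility using (_∣_; divides; ∣⇒≤)
open import Data.Nat.Primality using (prime?; euclidsLemma)
open import Data.Nat.Solver using (module +-*-Solver)
import Data.Integer as ℤ
import Data.Integer.Properties as ℤP
open import Data.Rational using (_+_; toℚᵘ)
import Data.Rational.Properties as ℚP
open import Data.Rational.Solver using () renaming (module +-*-Solver to ℚ-Solver)
open import Data.Rational.Unnormalised as ℚᵘ using (mkℚᵘ) renaming (_≃_ to _≃ᵘ_)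
import Data.Rational.Unnormalised.Properties as ℚᵘP
open import Data.Fin using () renaming (zero to fzero; suc to fsuc)
open import Data.Fin.Subset using (Subset)
open import Data.Sum using (inj₁; inj₂)
open import Relation.Nullary using (¬_)
open import Relation.Nullary.Decidable using (dec-true; from-yes)
open import Relation.Binary.PropositionalEquality
  using (refl; sym; trans; cong; cong₂; subst; subst₂; _≢_; module ≡-Reasoning)

toℚᵘ-frac : ∀ a k → toℚᵘ (frac a (suc k)) ≃ᵘ mkℚᵘ (+ a) k
toℚᵘ-frac a k = ℚP.toℚᵘ-fromℚᵘ (mkℚᵘ (+ a) k)

*≤*⇒frac≤frac : ∀ a b {m n} → 0 < m → 0 < n → a ℕ.* n ℕ.≤ b ℕ.* m → frac a m ≤ℚ frac b n
*≤*⇒frac≤frac a b {suc k} {suc l} _ _ an≤bm = ℚP.toℚᵘ-cancel-≤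
  (ℚᵘP.≤-respˡ-≃ (ℚᵘP.≃-sym (toℚᵘ-frac a k)) (ℚᵘP.≤-respʳ-≃ (ℚᵘP.≃-sym (toℚᵘ-frac b l))
    (ℚᵘ.*≤* (subst₂ ℤ._≤_ (ℤP.pos-* a (suc l)) (ℤP.pos-* b (suc k)) (ℤ.+≤+ an≤bm)))))

*<*⇒frac<frac : ∀ a b {m n} → 0 < m → 0 < n → a ℕ.* n < b ℕ.* m → frac a m <ℚ frac b n
*<*⇒frac<frac a b {suc k} {suc l} _ _ an<bm = ℚP.toℚᵘ-cancel-<
  (ℚᵘP.<-respˡ-≃ (ℚᵘP.≃-sym (toℚᵘ-frac a k)) (ℚᵘP.<-respʳ-≃ (ℚᵘP.≃-sym (toℚᵘ-frac b l))
    (ℚᵘ.*<* (subst₂ ℤ._<_ (ℤP.pos-* a (suc l)) (ℤP.pos-* b (suc k)) (ℤ.+<+ an<bm)))))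

frac≤frac⇒*≤* : ∀ a b {m n} → 0 < m → 0 < n → frac a m ≤ℚ frac b n → a ℕ.* n ℕ.≤ b ℕ.* m
frac≤frac⇒*≤* a b m>0 n>0 a/m≤b/n =
  ℕP.≮⇒≥ (λ bm<an → ℚP.<-irrefl refl (ℚP.<-≤-trans (*<*⇒frac<frac b a n>0 m>0 bm<an) a/m≤b/n))

*≡*⇒frac≡frac : ∀ a b {m n} → 0 < m → 0 < n → a ℕ.* n ≡ b ℕ.* m → frac a m ≡ frac b n
*≡*⇒frac≡frac a b m>0 n>0 an≡bm = ℚP.≤-antisym
  (*≤*⇒frac≤frac a b m>0 n>0 (ℕP.≤-reflexive an≡bm))
  (*≤*⇒frac≤frac b a n>0 m>0 (ℕP.≤-reflexive (sym an≡bm)))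

frac-+-frac : ∀ a b k l →
  frac a (suc k) + frac b (suc l) ≡ frac (a ℕ.* suc l ℕ.+ b ℕ.* suc k) (suc k ℕ.* suc l)
frac-+-frac a b k l = ℚP.toℚᵘ-injective (ℚᵘP.≃-trans (ℚP.toℚᵘ-homo-+ (frac a (suc k)) (frac b (suc l)))
  (ℚᵘP.≃-trans (ℚᵘP.+-cong (toℚᵘ-frac a k) (toℚᵘ-frac b l))
  (ℚᵘP.≃-trans (ℚᵘP.≃-reflexive (cong (λ z → mkℚᵘ z _) numerator)) (ℚᵘP.≃-sym (toℚᵘ-frac _ _)))))
  where
  numerator : + a ℤ.* + suc l ℤ.+ + b ℤ.* + suc k ≡ + (a ℕ.* suc l ℕ.+ b ℕ.* suc k)
  numerator = trans (cong₂ ℤ._+_ (sym (ℤP.pos-* a (suc l))) (sym (ℤP.pos-* b (suc k))))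
                    (sym (ℤP.pos-+ (a ℕ.* suc l) (b ℕ.* suc k)))

frac-*-frac : ∀ a b k l → frac a (suc k) * frac b (suc l) ≡ frac (a ℕ.* b) (suc k ℕ.* suc l)
frac-*-frac a b k l = ℚP.toℚᵘ-injective (ℚᵘP.≃-trans (ℚP.toℚᵘ-homo-* (frac a (suc k)) (frac b (suc l)))
  (ℚᵘP.≃-trans (ℚᵘP.*-cong (toℚᵘ-frac a k) (toℚᵘ-frac b l))
  (ℚᵘP.≃-trans (ℚᵘP.≃-reflexive (cong (λ z → mkℚᵘ z _) (sym (ℤP.pos-* a b)))) (ℚᵘP.≃-sym (toℚᵘ-frac _ _)))))

frac-distribʳ-+ : ∀ a b n → frac (a ℕ.+ b) n ≡ frac a n + frac b n
frac-distribʳ-+ a b zero    = refl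
frac-distribʳ-+ a b (suc k) = begin
  frac (a ℕ.+ b) n                    ≡⟨ *≡*⇒frac≡frac (a ℕ.+ b) (a ℕ.* n ℕ.+ b ℕ.* n) n>0 n²>0 cross ⟩
  frac (a ℕ.* n ℕ.+ b ℕ.* n) (n ℕ.* n) ≡⟨ frac-+-frac a b k k ⟨
  frac a n + frac b n                 ∎
  where
  open ≡-Reasoning
  open +-*-Solver
  n = suc k
  n>0 : 0 < n
  n>0 = ℕP.0<1+n
  n²>0 : 0 < n ℕ.* n
  n²>0 = ℕP.0<1+n
  cross : (a ℕ.+ b) ℕ.* (n ℕ.* n) ≡ (a ℕ.* n ℕ.+ b ℕ.* n) ℕ.* n
  cross = solve 3 (λ a b n → (a :+ b) :* (n :* n) := (a :* n :+ b :* n) :* n) refl a b n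

frac-monoˡ-≤ : ∀ {a b} n → a ℕ.≤ b → frac a n ≤ℚ frac b n
frac-monoˡ-≤ zero    _   = ℚP.≤-refl
frac-monoˡ-≤ {a} {b} (suc k) a≤b = *≤*⇒frac≤frac a b ℕP.0<1+n ℕP.0<1+n (ℕP.*-monoˡ-≤ (suc k) a≤b)

frac[n,n]≡1 : ∀ {n} → 0 < n → frac n n ≡ 1ℚ
frac[n,n]≡1 {n} n>0 = *≡*⇒frac≡frac n 1 n>0 ℕP.0<1+n (sym (ℕP.*-comm 1 n))

x+y≡z⇒x≡z-y : ∀ {x y z} → x + y ≡ z → x ≡ z - y
x+y≡z⇒x≡z-y {x} {y} refl = solve 2 (λ x y → x := x :+ y :- y) refl x y
  where open ℚ-Solver

x*yz≡y*xz : ∀ x y z → x * (y * z) ≡ y * (x * z)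
x*yz≡y*xz = solve 3 (λ x y z → x :* (y :* z) := y :* (x :* z)) refl
  where open ℚ-Solver

-‿antimonoʳ-≤ : ∀ r {p q} → p ≤ℚ q → r - q ≤ℚ r - p
-‿antimonoʳ-≤ r p≤q = ℚP.+-monoʳ-≤ r (ℚP.neg-antimono-≤ p≤q)

pow½≤1 : ∀ i → pow½ i ≤ℚ 1ℚ
pow½≤1 zero    = ℚP.≤-refl
pow½≤1 (suc i) = ℚP.≤-trans (ℚP.*-monoˡ-≤-nonNeg ½ (pow½≤1 i)) (from-yes (½ ℚP.≤? 1ℚ))

countT-complement : ∀ {n} (p : Fin n → Bool) → countT p ℕ.+ countT (not ∘ p) ≡ n
countT-complement {zero}  p = refl
countT-complement {suc n} p with p fzero
... | true  = cong suc (countT-complement (p ∘ fsuc))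
... | false = trans (ℕP.+-suc _ _) (cong suc (countT-complement (p ∘ fsuc)))

countT-mono : ∀ {n} {p q : Fin n → Bool} → (∀ k → p k ≡ true → q k ≡ true) → countT p ℕ.≤ countT q
countT-mono {zero}          p⇒q = z≤n
countT-mono {suc n} {p} {q} p⇒q with p fzero in p0 | q fzero in q0
... | true  | true  = s≤s (countT-mono (p⇒q ∘ fsuc))
... | true  | false = case trans (sym q0) (p⇒q fzero p0) of λ ()
... | false | true  = ℕP.m≤n⇒m≤1+n (countT-mono (p⇒q ∘ fsuc))
... | false | false = countT-mono (p⇒q ∘ fsuc)

avg+avg-not≡1 : ∀ {n} (x : Fin n → Bool) → 0 < n → avg x + avg (not ∘ x) ≡ 1ℚ
avg+avg-not≡1 {n} x n>0 = begin
  avg x + avg (not ∘ x)                  ≡⟨ frac-distribʳ-+ (countT x) (countT (not ∘ x)) n ⟨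
  frac (countT x ℕ.+ countT (not ∘ x)) n ≡⟨ cong (λ c → frac c n) (countT-complement x) ⟩
  frac n n                               ≡⟨ frac[n,n]≡1 n>0 ⟩
  1ℚ                                     ∎
  where open ≡-Reasoning

avg≡1-avg-not : ∀ {n} (x : Fin n → Bool) → 0 < n → avg x ≡ 1ℚ - avg (not ∘ x)
avg≡1-avg-not x n>0 = x+y≡z⇒x≡z-y (avg+avg-not≡1 x n>0)

avg-not≡1-avg : ∀ {n} (x : Fin n → Bool) → 0 < n → avg (not ∘ x) ≡ 1ℚ - avg x
avg-not≡1-avg x n>0 = x+y≡z⇒x≡z-y (trans (ℚP.+-comm (avg (not ∘ x)) (avg x)) (avg+avg-not≡1 x n>0))

5∤2^ : ∀ e → ¬ 5 ∣ 2 ℕ.^ e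
5∤2^ zero    5∣1 = case ∣⇒≤ 5∣1 of λ { (s≤s ()) }
5∤2^ (suc e) 5∣2^1+e with euclidsLemma 2 (2 ℕ.^ e) (from-yes (prime? 5)) 5∣2^1+e
... | inj₁ 5∣2   = case ∣⇒≤ 5∣2 of λ { (s≤s (s≤s ())) }
... | inj₂ 5∣2^e = 5∤2^ e 5∣2^e

⅒ : ℚ
⅒ = (+ 1) / 10

dyadic≤⅒⇒<⅒ : ∀ c e → frac c (2 ℕ.^ e) ≤ℚ ⅒ → frac c (2 ℕ.^ e) <ℚ ⅒
dyadic≤⅒⇒<⅒ c e c/2^e≤⅒ = *<*⇒frac<frac c 1 2^e>0 ℕP.0<1+n
  (ℕP.≤∧≢⇒< (frac≤frac⇒*≤* c 1 2^e>0 ℕP.0<1+n c/2^e≤⅒) 10c≢2^e)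
  where
  open +-*-Solver
  2^e>0 : 0 < 2 ℕ.^ e
  2^e>0 = ℕP.m^n>0 2 e
  10c≢2^e : c ℕ.* 10 ≢ 1 ℕ.* 2 ℕ.^ e
  10c≢2^e eq = 5∤2^ e (divides (2 ℕ.* c)
    (trans (sym (trans eq (ℕP.*-identityˡ _))) (solve 1 (λ c → c :* con 10 := con 2 :* c :* con 5) refl c)))

frac*≰⇒frac< : ∀ a k o s → ¬ (frac a (suc k) * toℚ s ≤ℚ toℚ o) → frac o s <ℚ frac a (suc k)
frac*≰⇒frac< a k o s a/b*s≰o = *<*⇒frac<frac o a s>0 ℕP.0<1+n ob<as
  where
  ob<as : o ℕ.* suc k < a ℕ.* s
  ob<as = ℕP.≰⇒> λ as≤ob → a/b*s≰o (subst (_≤ℚ toℚ o) (sym (frac-*-frac a s k 0))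
    (*≤*⇒frac≤frac (a ℕ.* s) o ℕP.0<1+n ℕP.0<1+n
      (subst₂ ℕ._≤_ (sym (ℕP.*-identityʳ (a ℕ.* s))) (cong (o ℕ.*_) (sym (ℕP.*-identityʳ (suc k)))) as≤ob)))
  s>0 : 0 < s
  s>0 = ℕP.n≢0⇒n>0 λ { refl → ℕP.n≮0 (subst (o ℕ.* suc k <_) (ℕP.*-zeroʳ a) ob<as) }

thr-false⇒avgOn< : ∀ {n} a k (S : Subset n) (x : Fin n → Bool)
  → thr (frac a (suc k)) S x ≡ false → avgOn S x <ℚ frac a (suc k)
thr-false⇒avgOn< a k S x thr≡false = frac*≰⇒frac< a k (onesIn S x) (size S)
  λ above → case trans (sym (dec-true (_ ℚP.≤? _) above)) thr≡false of λ ()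

zeros-halve : ∀ {n n'} (x : Fin n → Bool) (x' : Fin n' → Bool) (bad : Fin n' → Bool) → 0 < n
  → (∀ j → not (x' j) ≡ true → bad j ≡ true)
  → (∀ η → η <ℚ ⅒ → 1ℚ - η ≤ℚ avg x → prob bad ≤ℚ ½ * η)
  → avg (not ∘ x) <ℚ ⅒
  → avg (not ∘ x') ≤ℚ ½ * avg (not ∘ x)
zeros-halve {n' = n'} x x' bad n>0 zero⇒bad sampler few-zeros = begin
  avg (not ∘ x')    ≤⟨ frac-monoˡ-≤ n' (countT-mono zero⇒bad) ⟩
  prob bad          ≤⟨ sampler (avg (not ∘ x)) few-zeros (ℚP.≤-reflexive (sym (avg≡1-avg-not x n>0))) ⟩
  ½ * avg (not ∘ x) ∎
  where open ℚP.≤-Reasoning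

width>0 : ∀ d i → 0 < width d i
width>0 d i = ℕP.m^n>0 2 (d ∸ i)

layer-zeros≤ : ∀ d (S : Families d) (y0 : Fin (2 ℕ.^ d) → Bool)
  → (∀ i → i < d → ∀ η → η <ℚ ⅒ → ∀ (x : Fin (width d i) → Bool) → 1ℚ - η ≤ℚ avg x
       → prob (λ j → does (avgOn (S i j) x <? (+ 8) / 10)) ≤ℚ ½ * η)
  → (+ 9) / 10 ≤ℚ avg y0
  → ∀ i → i ℕ.≤ d → avg (not ∘ layer d S y0 i) ≤ℚ ⅒ * pow½ i
layer-zeros≤ d S y0 sampler dense zero    _   = begin
  avg (not ∘ y0)  ≡⟨ avg-not≡1-avg y0 (width>0 d 0) ⟩
  1ℚ - avg y0     ≤⟨ -‿antimonoʳ-≤ 1ℚ dense ⟩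
  1ℚ - (+ 9) / 10 ≡⟨⟩
  ⅒ * pow½ 0      ∎
  where open ℚP.≤-Reasoning
layer-zeros≤ d S y0 sampler dense (suc i) i<d = begin
  avg (not ∘ y (suc i)) ≤⟨ zeros-halve (y i) (y (suc i)) _ (width>0 d i) output0⇒below
                             (λ η η<⅒ → sampler i i<d η η<⅒ (y i))
                             (dyadic≤⅒⇒<⅒ _ (d ∸ i) (ℚP.≤-trans IH (ℚP.*-monoˡ-≤-nonNeg ⅒ (pow½≤1 i)))) ⟩
  ½ * avg (not ∘ y i)   ≤⟨ ℚP.*-monoˡ-≤-nonNeg ½ IH ⟩
  ½ * (⅒ * pow½ i)      ≡⟨ x*yz≡y*xz ½ ⅒ (pow½ i) ⟩
  ⅒ * pow½ (suc i)      ∎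
  where
  open ℚP.≤-Reasoning
  y = layer d S y0
  IH : avg (not ∘ y i) ≤ℚ ⅒ * pow½ i
  IH = layer-zeros≤ d S y0 sampler dense i (ℕP.<⇒≤ i<d)
  output0⇒below : ∀ j → not (y (suc i) j) ≡ true → does (avgOn (S i j) (y i) <? (+ 8) / 10) ≡ true
  output0⇒below j y≡0 = dec-true (_ <? _) (thr-false⇒avgOn< 8 9 (S i j) (y i) (not-injective y≡0))

lemma3 : (d : ℕ) (S : Families d) (y0 : Fin (2 ℕ.^ d) → Bool)
    → (∀ i → i < d → ∀ (x : Fin (width d i) → Bool)
         → prob (λ j → does ((+ 1) / 10 <? ∣ avgOn (S i j) x - avg x ∣)) ≤ℚ (+ 6) / 10)
    → (∀ i → i < d → ∀ (η : ℚ) → η <ℚ (+ 1) / 10 → ∀ (x : Fin (width d i) → Bool)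
         → 1ℚ - η ≤ℚ avg x
         → prob (λ j → does (avgOn (S i j) x <? (+ 8) / 10)) ≤ℚ ½ * η)
    → (∀ i → i < d → ∃ λ (s : ℕ) → ∀ (j : Fin (width d (suc i))) → size (S i j) ≡ s)
    → (+ 9) / 10 ≤ℚ avg y0
    → ∀ i → i ℕ.≤ d → 1ℚ - (+ 1) / 10 * pow½ i ≤ℚ avg (layer d S y0 i)
lemma3 d S y0 _ sampler _ dense i i≤d = begin
  1ℚ - ⅒ * pow½ i                 ≤⟨ -‿antimonoʳ-≤ 1ℚ (layer-zeros≤ d S y0 sampler dense i i≤d) ⟩
  1ℚ - avg (not ∘ layer d S y0 i) ≡⟨ avg≡1-avg-not (layer d S y0 i) (width>0 d i) ⟨
  avg (layer d S y0 i)            ∎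
  where open ℚP.≤-Reasoning
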